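{- Let $M$ be a $0,1$ matrix of size $n \times m$. There exists a graph $G_M$ with $O(n\cdot m)$ vertices such that $\chi(G_M) = \mathrm{rank}_{\mathbb{B}}(M)$.
   Context: For a $0,1$ matrix $M$ of size $n\times m$, its Boolean rank $\mathrm{rank}_{\mathbb{B}}(M)$ is the minimal $d$ for which there exist $0,1$ matrices $A$ ($n\times d$) and $B$ ($d\times m$) with $M=A\cdot B$, where the arithmetic is Boolean ($0+x=x+0=x$, $1+1=1\cdot 1=1$, $x\cdot 0=0\cdot x=0$). Equivalently, it is the minimum number of all-ones combinatorial rectangles (submatrices, with rows and columns not necessarily consecutive, all of whose entries are $1$) needed to cover all $1$-entries of $M$, rectangles being allowed to overlap. $\chi(G)$ denotes the chromatic number of a graph $G$. -}

module Defs where

open import Data.Nat using (ℕ; zero; suc; _≤_)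
open import Data.Fin using (Fin; zero; suc)
open import Data.Bool using (Bool; true; false; _∧_; _∨_)
open import Data.Product using (Σ; ∃; ∃-syntax; _×_)
open import Relation.Binary.PropositionalEquality using (_≡_; _≢_)

BMatrix : ℕ → ℕ → Set
BMatrix n m = Fin n → Fin m → Bool

bigOr : (d : ℕ) → (Fin d → Bool) → Bool
bigOr zero    f = false
bigOr (suc d) f = f zero ∨ bigOr d (λ l → f (suc l))

_⊙_ : ∀ {n d m} → BMatrix n d → BMatrix d m → BMatrix n m
_⊙_ {d = d} A B i j = bigOr d (λ l → A i l ∧ B l j)

BoolFactorizable : ∀ {n m} → BMatrix n m → ℕ → Set
BoolFactorizable {n} {m} M d =
  Σ (BMatrix n d) λ A → Σ (BMatrix d m) λ B → ∀ i j → (A ⊙ B) i j ≡ M i j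

IsBoolRank : ∀ {n m} → BMatrix n m → ℕ → Set
IsBoolRank M r = BoolFactorizable M r × (∀ d → BoolFactorizable M d → r ≤ d)

record Graph (k : ℕ) : Set where
  field
    Adj    : Fin k → Fin k → Bool
    sym    : ∀ u v → Adj u v ≡ Adj v u
    irrefl : ∀ u → Adj u u ≡ false
open Graph public

ProperColouring : ∀ {k} → Graph k → (c : ℕ) → (Fin k → Fin c) → Set
ProperColouring G c col = ∀ u v → Adj G u v ≡ true → col u ≢ col v

Colourable : ∀ {k} → Graph k → ℕ → Set
Colourable {k} G c = Σ (Fin k → Fin c) λ col → ProperColouring G c col

IsChromaticNumber : ∀ {k} → Graph k → ℕ → Set
IsChromaticNumber G r = Colourable G r × (∀ c → Colourable G c → r ≤ c)

{-# OPTIONS --safe #-}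
module Submission where

-- Take the entries of M as vertices and join two 1-entries (i , j), (i′ , j′)
-- when no all-ones rectangle contains both, i.e. when M i j′ or M i′ j is 0.
-- A proper colouring is then a colouring of the entries in which every
-- colour class of 1-entries lies in the all-ones rectangle spanned by its
-- rows and columns: these rectangles cover M, and conversely a cover by d
-- rectangles colours each 1-entry by a rectangle containing it. The zero
-- matrix has Boolean rank 0 while its conflict graph has isolated vertices,
-- so it gets the empty graph instead.

open import Defs
open import Data.Nat using (ℕ; _≤_; _*_)
open import Data.Product using (Σ; ∃-syntax; _×_)

open import Data.Bool using (Bool; true; false; _∧_; not)
open import Data.Bool.Properties using (¬-not; not-injective; ∧-comm) renaming (_≟_ to _≟ᵇ_)
open import Data.Empty using (⊥-elim)
open import Data.Fin using (Fin; zero; suc; remQuot; combine; finToFun; funToFin)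
open import Data.Fin.Properties using (any?; all?; remQuot-combine; finToFun-funToFin)
  renaming (_≟_ to _≟ᶠ_)
open import Data.Nat as ℕ using (z≤n; _<_)
open import Data.Nat.Induction using (<-rec)
open import Data.Nat.Properties using (≮⇒≥; m≤n*m; anyUpTo?)
open import Data.Product using (∃; _,_; proj₁; uncurry)
open import Function using (_∘_)
open import Relation.Nullary using (Dec; yes; no; does; ¬_)
open import Relation.Nullary.Decidable using (map′; dec-true; _×-dec_; _→-dec_; ¬?)
open import Relation.Unary using (Pred; Decidable)
open import Relation.Binary.PropositionalEquality as ≡
  using (_≡_; _≗_; refl; trans; cong; cong₂; subst; subst₂)

∧≡true⁻ : ∀ {a b} → a ∧ b ≡ true → a ≡ true × b ≡ true
∧≡true⁻ {true} {true} _ = refl , refl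

dec-true⁻ : ∀ {p} {P : Set p} (p? : Dec P) → does p? ≡ true → P
dec-true⁻ (yes p) _ = p

bigOr⁺ : ∀ {d} (f : Fin d → Bool) l → f l ≡ true → bigOr d f ≡ true
bigOr⁺ f zero    fl≡true rewrite fl≡true = refl
bigOr⁺ f (suc l) fl≡true with f zero
... | true  = refl
... | false = bigOr⁺ (f ∘ suc) l fl≡true

bigOr⁻ : ∀ {d} (f : Fin d → Bool) → bigOr d f ≡ true → ∃ λ l → f l ≡ true
bigOr⁻ {ℕ.zero}  f ()
bigOr⁻ {ℕ.suc d} f or≡true with f zero in f0≡true
... | true  = zero , f0≡true
... | false with bigOr⁻ (f ∘ suc) or≡true
...   | l , fl≡true = suc l , fl≡true

module _ {n d m} (A : BMatrix n d) (B : BMatrix d m) {i : Fin n} {j : Fin m} where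

  ⊙⁺ : ∀ l → A i l ≡ true → B l j ≡ true → (A ⊙ B) i j ≡ true
  ⊙⁺ l Ail≡true Blj≡true = bigOr⁺ (λ l → A i l ∧ B l j) l (cong₂ _∧_ Ail≡true Blj≡true)

  ⊙⁻ : (A ⊙ B) i j ≡ true → ∃ λ l → A i l ≡ true × B l j ≡ true
  ⊙⁻ AB≡true with bigOr⁻ (λ l → A i l ∧ B l j) AB≡true
  ... | l , AB≡true = l , ∧≡true⁻ AB≡true

module _ {p} {P : Pred ℕ p} (P? : Decidable P) where

  Least : Set p
  Least = ∃ λ r → P r × (∀ c → P c → r ≤ c)

  least : ∀ v → P v → Least
  least = <-rec (λ v → P v → Least) step
    where
    step : ∀ v → (∀ {u} → u < v → P u → Least) → P v → Least
    step v smaller Pv with anyUpTo? P? v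
    ... | yes (u , u<v , Pu) = smaller u<v Pu
    ... | no  ¬smaller       = v , Pv , λ c Pc → ≮⇒≥ λ c<v → ¬smaller (c , c<v , Pc)

module _ {k} (G : Graph k) where

  properColouring? : ∀ c col → Dec (ProperColouring G c col)
  properColouring? c col =
    all? λ u → all? λ v → (Adj G u v ≟ᵇ true) →-dec ¬? (col u ≟ᶠ col v)

  properColouring-resp-≗ : ∀ {c col col′} → col ≗ col′ →
                           ProperColouring G c col → ProperColouring G c col′
  properColouring-resp-≗ col≗col′ proper u v uv col′u≡col′v =
    proper u v uv (trans (col≗col′ u) (trans col′u≡col′v (≡.sym (col≗col′ v))))

  -- A colouring with c colours is coded by an element of Fin (c ^ k).
  colourable? : ∀ c → Dec (Colourable G c)
  colourable? c = map′
    (λ (code , proper) → finToFun code , proper)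
    (λ (col , proper) → funToFin col ,
       properColouring-resp-≗ (≡.sym ∘ finToFun-funToFin col) proper)
    (any? λ code → properColouring? c (finToFun code))

  colourable-by-vertices : Colourable G k
  colourable-by-vertices = (λ u → u) , adjacent⇒distinct
    where
    adjacent⇒distinct : ProperColouring G k (λ u → u)
    adjacent⇒distinct u .u uu refl with trans (≡.sym uu) (irrefl G u)
    ... | ()

  chromaticNumber : ∃ (IsChromaticNumber G)
  chromaticNumber = least colourable? k colourable-by-vertices

module _ {n m} (M : BMatrix n m) where

  RectangleColouring : (c : ℕ) → (Fin n → Fin m → Fin c) → Set
  RectangleColouring c col = ∀ {i i′ j j′} → M i j ≡ true → M i′ j′ ≡ true →
                             col i j ≡ col i′ j′ → M i j′ ≡ true

  rectangleColouring⇒factorizable : ∀ {c col} → RectangleColouring c col →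
                                    BoolFactorizable M c
  rectangleColouring⇒factorizable {c} {col} rectangle = A , B , A⊙B≡M
    where
    rowMeets? : ∀ i l → Dec (∃ λ j → M i j ≡ true × col i j ≡ l)
    rowMeets? i l = any? λ j → (M i j ≟ᵇ true) ×-dec (col i j ≟ᶠ l)

    columnMeets? : ∀ l j → Dec (∃ λ i → M i j ≡ true × col i j ≡ l)
    columnMeets? l j = any? λ i → (M i j ≟ᵇ true) ×-dec (col i j ≟ᶠ l)

    A : BMatrix n c
    A i l = does (rowMeets? i l)

    B : BMatrix c m
    B l j = does (columnMeets? l j)

    A⊙B≡M : ∀ i j → (A ⊙ B) i j ≡ M i j
    A⊙B≡M i j with M i j in Mij
    ... | true  = ⊙⁺ A B (col i j) (dec-true (rowMeets? i (col i j)) (j , Mij , refl))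
                                   (dec-true (columnMeets? (col i j) j) (i , Mij , refl))
    ... | false = ¬-not λ A⊙B≡true → noInnerIndex (⊙⁻ A B A⊙B≡true)
      where
      noInnerIndex : ¬ (∃ λ l → A i l ≡ true × B l j ≡ true)
      noInnerIndex (l , Ail , Blj)
        with dec-true⁻ (rowMeets? i l) Ail | dec-true⁻ (columnMeets? l j) Blj
      ... | j′ , Mij′ , colij′ | i′ , Mi′j , coli′j
        with trans (≡.sym (rectangle Mij′ Mi′j (trans colij′ (≡.sym coli′j)))) Mij
      ... | ()

  factorizable⇒rectangleColouring : ∀ {d} → BoolFactorizable M d → Fin d →
                                    ∃ (RectangleColouring d)
  factorizable⇒rectangleColouring {d} (A , B , A⊙B≡M) default = through , rectangle
    where
    through? : ∀ i j → Dec (∃ λ l → A i l ≡ true × B l j ≡ true)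
    through? i j = any? λ l → (A i l ≟ᵇ true) ×-dec (B l j ≟ᵇ true)

    through : Fin n → Fin m → Fin d
    through i j with through? i j
    ... | yes (l , _) = l
    ... | no  _       = default

    through-correct : ∀ {i j} → M i j ≡ true →
                      A i (through i j) ≡ true × B (through i j) j ≡ true
    through-correct {i} {j} Mij with through? i j
    ... | yes (_ , spec) = spec
    ... | no  none       = ⊥-elim (none (⊙⁻ A B (trans (A⊙B≡M i j) Mij)))

    rectangle : RectangleColouring d through
    rectangle {i} {i′} {j} {j′} Mij Mi′j′ same
      with through-correct Mij | through-correct Mi′j′
    ... | Ail , _ | _ , Bl′j′ = trans (≡.sym (A⊙B≡M i j′)) (⊙⁺ A B _ Ail Blj′)
      where
      Blj′ : B (through i j) j′ ≡ true
      Blj′ = subst (λ l → B l j′ ≡ true) (≡.sym same) Bl′j′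

  conflict : Fin n × Fin m → Fin n × Fin m → Bool
  conflict (i , j) (i′ , j′) = M i j ∧ M i′ j′ ∧ not (M i j′ ∧ M i′ j)

  conflict-sym : ∀ p q → conflict p q ≡ conflict q p
  conflict-sym (i , j) (i′ , j′) with M i j | M i′ j′
  ... | true  | true  = cong not (∧-comm (M i j′) (M i′ j))
  ... | true  | false = refl
  ... | false | true  = refl
  ... | false | false = refl

  conflict-irrefl : ∀ p → conflict p p ≡ false
  conflict-irrefl (i , j) with M i j
  ... | true  = refl
  ... | false = refl

  conflict⁺ : ∀ {i i′ j j′} → M i j ≡ true → M i′ j′ ≡ true → M i j′ ≡ false →
              conflict (i , j) (i′ , j′) ≡ true
  conflict⁺ Mij Mi′j′ Mij′ rewrite Mij | Mi′j′ | Mij′ = refl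

  conflict⁻ : ∀ {i i′ j j′} → conflict (i , j) (i′ , j′) ≡ true →
              M i j ≡ true × M i′ j′ ≡ true × M i j′ ∧ M i′ j ≡ false
  conflict⁻ {i} {i′} {j} {j′} ij-i′j′ with ∧≡true⁻ {M i j} ij-i′j′
  ... | Mij , rest with ∧≡true⁻ {M i′ j′} rest
  ...   | Mi′j′ , notCross = Mij , Mi′j′ , not-injective notCross

  conflictGraph : Graph (n * m)
  conflictGraph = record
    { Adj    = λ u v → conflict (remQuot m u) (remQuot m v)
    ; sym    = λ u v → conflict-sym (remQuot m u) (remQuot m v)
    ; irrefl = λ u → conflict-irrefl (remQuot m u)
    }

  rectangleColouring⇒proper : ∀ {c col} → RectangleColouring c col →
                              ProperColouring conflictGraph c (uncurry col ∘ remQuot m)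
  rectangleColouring⇒proper rectangle u v uv same with conflict⁻ uv
  ... | Mij , Mi′j′ , cross≡false
    with trans (≡.sym cross≡false)
               (cong₂ _∧_ (rectangle Mij Mi′j′ same) (rectangle Mi′j′ Mij (≡.sym same)))
  ... | ()

  proper⇒rectangleColouring : ∀ {c col} → ProperColouring conflictGraph c col →
                              RectangleColouring c (λ i j → col (combine i j))
  proper⇒rectangleColouring proper {i} {i′} {j} {j′} Mij Mi′j′ same
    with M i j′ in Mij′
  ... | true  = refl
  ... | false = ⊥-elim (proper (combine i j) (combine i′ j′) adjacent same)
    where
    adjacent : Adj conflictGraph (combine i j) (combine i′ j′) ≡ true
    adjacent = subst₂ (λ p q → conflict p q ≡ true)
                      (≡.sym (remQuot-combine i j)) (≡.sym (remQuot-combine i′ j′))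
                      (conflict⁺ Mij Mi′j′ Mij′)

  conflictGraph-colourable⇒factorizable : ∀ {c} → Colourable conflictGraph c →
                                          BoolFactorizable M c
  conflictGraph-colourable⇒factorizable (_ , proper) =
    rectangleColouring⇒factorizable (proper⇒rectangleColouring proper)

  factorizable⇒conflictGraph-colourable : ∀ {i j d} → M i j ≡ true →
                                          BoolFactorizable M d → Colourable conflictGraph d
  factorizable⇒conflictGraph-colourable {i} {j} Mij fact@(A , B , A⊙B≡M)
    with factorizable⇒rectangleColouring fact (proj₁ (⊙⁻ A B (trans (A⊙B≡M i j) Mij)))
  ... | col , rectangle = uncurry col ∘ remQuot m , rectangleColouring⇒proper rectangle

  conflictGraph-chromaticNumber⇒boolRank : ∀ {i j r} → M i j ≡ true →
                                           IsChromaticNumber conflictGraph r → IsBoolRank M r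
  conflictGraph-chromaticNumber⇒boolRank Mij (colourable , minimal) =
    conflictGraph-colourable⇒factorizable colourable ,
    λ d fact → minimal d (factorizable⇒conflictGraph-colourable Mij fact)

  zeroMatrix-boolRank : (∀ i j → M i j ≡ false) → IsBoolRank M 0
  zeroMatrix-boolRank M≡0 = ((λ _ ()) , (λ ()) , λ i j → ≡.sym (M≡0 i j)) , λ _ _ → z≤n

emptyGraph : Graph 0
emptyGraph = record { Adj = λ () ; sym = λ () ; irrefl = λ () }

emptyGraph-chromaticNumber : IsChromaticNumber emptyGraph 0
emptyGraph-chromaticNumber = ((λ ()) , λ ()) , λ _ _ → z≤n

mainTheorem1 : ∃[ C ] (∀ (n m : ℕ) (M : BMatrix n m) →
                 ∃[ k ] (k ≤ C * (n * m) × Σ (Graph k) λ G →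
                   ∃[ r ] (IsChromaticNumber G r × IsBoolRank M r)))
mainTheorem1 = 1 , graphOf
  where
  graphOf : ∀ n m (M : BMatrix n m) →
            ∃[ k ] (k ≤ 1 * (n * m) × Σ (Graph k) λ G →
              ∃[ r ] (IsChromaticNumber G r × IsBoolRank M r))
  graphOf n m M with any? (λ i → any? λ j → M i j ≟ᵇ true)
  ... | no  M≡0 = 0 , z≤n , emptyGraph , 0 , emptyGraph-chromaticNumber ,
                  zeroMatrix-boolRank M λ i j → ¬-not λ Mij → M≡0 (i , j , Mij)
  ... | yes (i , j , Mij) with chromaticNumber (conflictGraph M)
  ...   | r , χ = n * m , m≤n*m (n * m) 1 , conflictGraph M , r , χ ,
                  conflictGraph-chromaticNumber⇒boolRank M Mij χ
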